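{- If $G$ is a finite cubic graph on $n$ vertices that has a DET:OLD set, then $\mathrm{DET{:}OLD\%}(G) = \mathrm{DET{:}OLD}(G)/n \le \frac{30}{31}$.
   Context: For a graph $G$ and $v\in V(G)$, $N(v)$ is the open neighborhood of $v$. For $S\subseteq V(G)$ write $N_S(v)=N(v)\cap S$. A set $S\subseteq V(G)$ is a DET:OLD set of $G$ if (1) every vertex $v$ satisfies $|N_S(v)|\ge 2$, and (2) every pair of distinct vertices $u,v$ satisfies $|N_S(u)\setminus N_S(v)|\ge 2$ or $|N_S(v)\setminus N_S(u)|\ge 2$. $\mathrm{DET{:}OLD}(G)$ is the minimum cardinality of a DET:OLD set of $G$. A cubic graph is a 3-regular simple graph. -}

module Defs where

open import Data.Nat using (ℕ; _≤_; _*_; _≥_)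
open import Data.Fin using (Fin)
open import Data.Fin.Subset using (Subset; _∈_; _∩_; _─_; ∣_∣)
open import Data.Product using (Σ; _×_; ∃)
open import Data.Sum using (_⊎_)
open import Relation.Binary.PropositionalEquality using (_≡_)
open import Relation.Nullary using (¬_)

record Graph (n : ℕ) : Set where
  field
    N       : Fin n → Subset n
    irrefl  : ∀ v → ¬ (v ∈ N v)
    sym     : ∀ u v → u ∈ N v → v ∈ N u

open Graph public

Cubic : ∀ {n} → Graph n → Set
Cubic {n} G = ∀ (v : Fin n) → ∣ N G v ∣ ≡ 3

N[_]_⟨_⟩ : ∀ {n} → Graph n → Subset n → Fin n → Subset n
N[ G ] S ⟨ v ⟩ = N G v ∩ S

IsDETOLD : ∀ {n} → Graph n → Subset n → Set
IsDETOLD {n} G S =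
  (∀ (v : Fin n) → ∣ N[ G ] S ⟨ v ⟩ ∣ ≥ 2) ×
  (∀ (u v : Fin n) → ¬ (u ≡ v) →
     (∣ N[ G ] S ⟨ u ⟩ ─ N[ G ] S ⟨ v ⟩ ∣ ≥ 2) ⊎
     (∣ N[ G ] S ⟨ v ⟩ ─ N[ G ] S ⟨ u ⟩ ∣ ≥ 2))

HasDETOLD : ∀ {n} → Graph n → Set
HasDETOLD G = ∃ λ S → IsDETOLD G S

IsDETOLDNumber : ∀ {n} → Graph n → ℕ → Set
IsDETOLDNumber G k =
  (∃ λ S → IsDETOLD G S × ∣ S ∣ ≡ k) ×
  (∀ S → IsDETOLD G S → k ≤ ∣ S ∣)

{-# OPTIONS --safe #-}
module Submission where

-- Call a and b in conflict if they have a common neighbour, or if a ∈ N(u) ∖ N(v)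
-- and b ∈ N(v) ∖ N(u) for distinct u, v with a common neighbour.  If a set R
-- contains no conflicting pair, its complement is a DET:OLD set: every
-- neighbourhood meets R at most once, and for u ≠ v the sides N(u) ∖ N(v) and
-- N(v) ∖ N(u) have equal size (G is cubic) and size at least 2 (G has some
-- DET:OLD set), so one of them keeps two vertices outside R unless both have
-- size 2 and both meet R; but then u and v have a common neighbour, and the
-- two vertices of R form a conflict.  In a cubic graph a vertex is in
-- conflict with at most 3·2 + 3·2·2·2 = 30 others, so picking vertices greedily
-- gives such an R with n ≤ 31 |R|, whence DET:OLD(G) ≤ n − |R| ≤ 30 n / 31.

open import Defs
open import Data.Nat using (ℕ; zero; suc; _+_; _*_; _∸_; _^_; _≤_; z≤n; s≤s)
open import Data.Nat.Properties
  using (≤-refl; n≤0⇒n≡0; ≤-reflexive; ≤-trans; ≤-pred; n≤1+n; +-suc; +-comm; +-mono-≤; +-monoʳ-≤;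
         +-cancelʳ-≤; +-cancelʳ-≡; *-suc; *-monoʳ-≤; *-monoˡ-≤; *-distribˡ-∸; ∸-monoʳ-≤;
         m+n∸m≡n; module ≤-Reasoning)
open import Data.Bool using (true; false)
open import Data.Fin using (Fin; zero; suc; _≟_)
open import Data.Fin.Properties using (0≢1+n; suc-injective)
open import Data.Fin.Subset
  using (Subset; _∈_; _∉_; _∩_; _∪_; _─_; _-_; ∁; ⁅_⁆; ∣_∣; _⊆_; Nonempty; Empty; ⊥; ⊤)
open import Data.Fin.Subset.Properties
  using (x∈p∩q⁺; x∈p∩q⁻; x∈p∪q⁺; x∈p∪q⁻; x∈p∧x∉q⇒x∈p─q; p─q⊆p; x∈p∧x≢y⇒x∈p-y;
         x∈⁅x⁆; x∈⁅y⁆⇒x≡y; x∉p⇒x∈∁p; ∉⊥; nonempty?; Empty-unique; ∪-identityˡ; ∩-comm;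
         ∣⊥∣≡0; ∣⊤∣≡n; ∣⁅x⁆∣≡1; ∣∁p∣≡n∸∣p∣; ∣p∩q∣≤∣q∣; p⊆q⇒∣p∣≤∣q∣;
         x∈p⇒∣p-x∣<∣p∣; p∩q≢∅⇒∣p─q∣<∣p∣)
open import Data.Vec using ([]; _∷_; here; there)
open import Data.Product using (_×_; _,_; ∃; proj₁; proj₂; swap) renaming (map to ×-map)
open import Data.Sum using (_⊎_; inj₁; inj₂; map₂)
open import Data.Empty using (⊥-elim)
open import Function using (_∘_)
import Relation.Binary.PropositionalEquality as Eq
open Eq using (_≡_; _≢_; refl; cong; subst)
open import Relation.Nullary using (¬_; yes; no)
open import Relation.Nullary.Decidable using (decidable-stable)

∣p∣≡∣p─q∣+∣p∩q∣ : ∀ {n} (p q : Subset n) → ∣ p ∣ ≡ ∣ p ─ q ∣ + ∣ p ∩ q ∣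
∣p∣≡∣p─q∣+∣p∩q∣ []          []          = refl
∣p∣≡∣p─q∣+∣p∩q∣ (true ∷ p)  (true ∷ q)  = Eq.trans (cong suc (∣p∣≡∣p─q∣+∣p∩q∣ p q)) (Eq.sym (+-suc _ _))
∣p∣≡∣p─q∣+∣p∩q∣ (true ∷ p)  (false ∷ q) = cong suc (∣p∣≡∣p─q∣+∣p∩q∣ p q)
∣p∣≡∣p─q∣+∣p∩q∣ (false ∷ p) (true ∷ q)  = ∣p∣≡∣p─q∣+∣p∩q∣ p q
∣p∣≡∣p─q∣+∣p∩q∣ (false ∷ p) (false ∷ q) = ∣p∣≡∣p─q∣+∣p∩q∣ p q

∣p∪q∣≤∣p∣+∣q∣ : ∀ {n} (p q : Subset n) → ∣ p ∪ q ∣ ≤ ∣ p ∣ + ∣ q ∣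
∣p∪q∣≤∣p∣+∣q∣ []          []          = z≤n
∣p∪q∣≤∣p∣+∣q∣ (true ∷ p)  (true ∷ q)  = s≤s (≤-trans (∣p∪q∣≤∣p∣+∣q∣ p q) (+-monoʳ-≤ ∣ p ∣ (n≤1+n ∣ q ∣)))
∣p∪q∣≤∣p∣+∣q∣ (true ∷ p)  (false ∷ q) = s≤s (∣p∪q∣≤∣p∣+∣q∣ p q)
∣p∪q∣≤∣p∣+∣q∣ (false ∷ p) (true ∷ q)  =
  subst (suc ∣ p ∪ q ∣ ≤_) (Eq.sym (+-suc ∣ p ∣ ∣ q ∣)) (s≤s (∣p∪q∣≤∣p∣+∣q∣ p q))
∣p∪q∣≤∣p∣+∣q∣ (false ∷ p) (false ∷ q) = ∣p∪q∣≤∣p∣+∣q∣ p q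

x∉p⇒∣⁅x⁆∪p∣≡1+∣p∣ : ∀ {n} (x : Fin n) (p : Subset n) → x ∉ p → ∣ ⁅ x ⁆ ∪ p ∣ ≡ suc ∣ p ∣
x∉p⇒∣⁅x⁆∪p∣≡1+∣p∣ zero    (true ∷ p)  x∉p = ⊥-elim (x∉p here)
x∉p⇒∣⁅x⁆∪p∣≡1+∣p∣ zero    (false ∷ p) x∉p = cong (suc ∘ ∣_∣) (∪-identityˡ p)
x∉p⇒∣⁅x⁆∪p∣≡1+∣p∣ (suc x) (true ∷ p)  x∉p = cong suc (x∉p⇒∣⁅x⁆∪p∣≡1+∣p∣ x p (x∉p ∘ there))
x∉p⇒∣⁅x⁆∪p∣≡1+∣p∣ (suc x) (false ∷ p) x∉p = x∉p⇒∣⁅x⁆∪p∣≡1+∣p∣ x p (x∉p ∘ there)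

x∈p─q⁻ : ∀ {n} {x : Fin n} (p q : Subset n) → x ∈ p ─ q → x ∈ p × x ∉ q
x∈p─q⁻ p q x∈p─q = p─q⊆p p q x∈p─q , x∉q p q x∈p─q
  where
  x∉q : ∀ {n} {x : Fin n} (p q : Subset n) → x ∈ p ─ q → x ∉ q
  x∉q (s ∷ p) (true ∷ q) () here
  x∉q (s ∷ p) (t ∷ q) (there x∈p─q) (there x∈q) = x∉q p q x∈p─q x∈q

p─q⊆p∩∁q : ∀ {n} (p q : Subset n) → p ─ q ⊆ p ∩ ∁ q
p─q⊆p∩∁q p q x∈p─q with x∈p─q⁻ p q x∈p─q
... | x∈p , x∉q = x∈p∩q⁺ (x∈p , x∉p⇒x∈∁p x∉q)

p∩r─q∩r⊆p─q : ∀ {n} (p q r : Subset n) → (p ∩ r) ─ (q ∩ r) ⊆ p ─ q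
p∩r─q∩r⊆p─q p q r x∈ with x∈p─q⁻ (p ∩ r) (q ∩ r) x∈
... | x∈p∩r , x∉q∩r with x∈p∩q⁻ p r x∈p∩r
... | x∈p , x∈r = x∈p∧x∉q⇒x∈p─q x∈p λ x∈q → x∉q∩r (x∈p∩q⁺ (x∈q , x∈r))

p─q─r⊆p∩∁r─q∩∁r : ∀ {n} (p q r : Subset n) → (p ─ q) ─ r ⊆ (p ∩ ∁ r) ─ (q ∩ ∁ r)
p─q─r⊆p∩∁r─q∩∁r p q r x∈ with x∈p─q⁻ (p ─ q) r x∈
... | x∈p─q , x∉r with x∈p─q⁻ p q x∈p─q
... | x∈p , x∉q = x∈p∧x∉q⇒x∈p─q (x∈p∩q⁺ (x∈p , x∉p⇒x∈∁p x∉r)) (x∉q ∘ proj₁ ∘ x∈p∩q⁻ q (∁ r))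

x∈⁅y⁆∪p⁻ : ∀ {n} {x y : Fin n} (p : Subset n) → x ∈ ⁅ y ⁆ ∪ p → x ≡ y ⊎ x ∈ p
x∈⁅y⁆∪p⁻ {y = y} p x∈ with x∈p∪q⁻ ⁅ y ⁆ p x∈
... | inj₁ x∈⁅y⁆ = inj₁ (x∈⁅y⁆⇒x≡y y x∈⁅y⁆)
... | inj₂ x∈p   = inj₂ x∈p

Empty⇒∣p∣≡0 : ∀ {n} (p : Subset n) → Empty p → ∣ p ∣ ≡ 0
Empty⇒∣p∣≡0 {n} p empty = Eq.trans (cong ∣_∣ (Empty-unique empty)) (∣⊥∣≡0 n)

1≤∣p∣⇒Nonempty : ∀ {n} (p : Subset n) → 1 ≤ ∣ p ∣ → Nonempty p
1≤∣p∣⇒Nonempty p 1≤∣p∣ with nonempty? p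
... | yes nonempty = nonempty
... | no empty with () ← subst (1 ≤_) (Empty⇒∣p∣≡0 p empty) 1≤∣p∣

∣p∣≤1 : ∀ {n} (p : Subset n) → (∀ {x y} → x ∈ p → y ∈ p → x ≡ y) → ∣ p ∣ ≤ 1
∣p∣≤1 []          _      = z≤n
∣p∣≤1 (true ∷ p)  unique =
  ≤-reflexive (cong suc (Empty⇒∣p∣≡0 p λ { (y , y∈p) → 0≢1+n (unique here (there y∈p)) }))
∣p∣≤1 (false ∷ p) unique = ∣p∣≤1 p λ x∈p y∈p → suc-injective (unique (there x∈p) (there y∈p))

⋃-over : ∀ {m n} → Subset m → (Fin m → Subset n) → Subset n
⋃-over []          f = ⊥
⋃-over (true ∷ p)  f = f zero ∪ ⋃-over p (f ∘ suc)
⋃-over (false ∷ p) f = ⋃-over p (f ∘ suc)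

syntax ⋃-over p (λ x → f) = ⋃[ x ∈ p ] f

∈⋃⁺ : ∀ {m n} {p : Subset m} {f : Fin m → Subset n} {x y} → x ∈ p → y ∈ f x → y ∈ ⋃-over p f
∈⋃⁺ {p = true ∷ p}  here        y∈fx = x∈p∪q⁺ (inj₁ y∈fx)
∈⋃⁺ {p = true ∷ p}  (there x∈p) y∈fx = x∈p∪q⁺ (inj₂ (∈⋃⁺ x∈p y∈fx))
∈⋃⁺ {p = false ∷ p} (there x∈p) y∈fx = ∈⋃⁺ x∈p y∈fx

∣⋃∣≤ : ∀ {m n} (p : Subset m) (f : Fin m → Subset n) {j k} →
       ∣ p ∣ ≤ j → (∀ {x} → x ∈ p → ∣ f x ∣ ≤ k) → ∣ ⋃-over p f ∣ ≤ j * k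
∣⋃∣≤ {n = n} p f {j} {k} ∣p∣≤j bound = ≤-trans (∣⋃∣≤∣p∣*k p f bound) (*-monoˡ-≤ k ∣p∣≤j)
  where
  ∣⋃∣≤∣p∣*k : ∀ {m} (p : Subset m) (f : Fin m → Subset n) →
              (∀ {x} → x ∈ p → ∣ f x ∣ ≤ k) → ∣ ⋃-over p f ∣ ≤ ∣ p ∣ * k
  ∣⋃∣≤∣p∣*k []          f bound = ≤-reflexive (∣⊥∣≡0 n)
  ∣⋃∣≤∣p∣*k (true ∷ p)  f bound =
    ≤-trans (∣p∪q∣≤∣p∣+∣q∣ (f zero) _) (+-mono-≤ (bound here) (∣⋃∣≤∣p∣*k p (f ∘ suc) (bound ∘ there)))
  ∣⋃∣≤∣p∣*k (false ∷ p) f bound = ∣⋃∣≤∣p∣*k p (f ∘ suc) (bound ∘ there)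

2≤x⊎[1≤e×1≤c] : ∀ x e c → e ≤ 1 → 2 ≤ x + e → x + e + c ≡ 3 → 2 ≤ x ⊎ (1 ≤ e × 1 ≤ c)
2≤x⊎[1≤e×1≤c] (suc (suc x)) e             c       _         _         _  = inj₁ (s≤s (s≤s z≤n))
2≤x⊎[1≤e×1≤c] x             (suc (suc e)) c       (s≤s ())  _         _
2≤x⊎[1≤e×1≤c] 0             0             c       _         ()        _
2≤x⊎[1≤e×1≤c] 0             1             c       _         (s≤s ())  _
2≤x⊎[1≤e×1≤c] 1             0             c       _         (s≤s ())  _
2≤x⊎[1≤e×1≤c] 1             1             0       _         _         ()
2≤x⊎[1≤e×1≤c] 1             1             (suc c) _         _         _  = inj₂ (s≤s z≤n , s≤s z≤n)

Independent : ∀ {n} → (Fin n → Fin n → Set) → Subset n → Set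
Independent _#_ R = ∀ {a b} → a ∈ R → b ∈ R → a ≢ b → ¬ a # b

module Greedy {n : ℕ} {_#_ : Fin n → Fin n → Set} (#-sym : ∀ {a b} → a # b → b # a)
              (C : Fin n → Subset n) (C-covers : ∀ {a b} → a ≢ b → a # b → b ∈ C a)
              {c : ℕ} (∣C∣≤c : ∀ a → ∣ C a ∣ ≤ c) where

  LargeIndependentSubset : Subset n → Set
  LargeIndependentSubset P = ∃ λ R → R ⊆ P × Independent _#_ R × ∣ P ∣ ≤ suc c * ∣ R ∣

  ∣P∣≡0⇒large : ∀ {P} → ∣ P ∣ ≡ 0 → LargeIndependentSubset P
  ∣P∣≡0⇒large ∣P∣≡0 = ⊥ , (⊥-elim ∘ ∉⊥) , (λ a∈⊥ → ⊥-elim (∉⊥ a∈⊥)) , subst (_≤ _) (Eq.sym ∣P∣≡0) z≤n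

  module _ {P : Subset n} {x : Fin n} (x∈P : x ∈ P) where

    blocked : Subset n
    blocked = ⁅ x ⁆ ∪ C x

    ∣P─blocked∣<∣P∣ : suc ∣ P ─ blocked ∣ ≤ ∣ P ∣
    ∣P─blocked∣<∣P∣ = p∩q≢∅⇒∣p─q∣<∣p∣ P blocked (x , x∈p∩q⁺ (x∈P , x∈p∪q⁺ (inj₁ (x∈⁅x⁆ x))))

    add : LargeIndependentSubset (P ─ blocked) → LargeIndependentSubset P
    add (R , R⊆ , independent , bound) = ⁅ x ⁆ ∪ R , ⊆P , independent′ , bound′
      where
      unblocked : ∀ {b} → b ∈ R → b ∉ blocked
      unblocked b∈R = proj₂ (x∈p─q⁻ P blocked (R⊆ b∈R))

      x∉R : x ∉ R
      x∉R x∈R = unblocked x∈R (x∈p∪q⁺ (inj₁ (x∈⁅x⁆ x)))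

      x-free : ∀ {b} → b ∈ R → x ≢ b → ¬ x # b
      x-free b∈R x≢b x#b = unblocked b∈R (x∈p∪q⁺ (inj₂ (C-covers x≢b x#b)))

      ⊆P : ⁅ x ⁆ ∪ R ⊆ P
      ⊆P a∈ with x∈⁅y⁆∪p⁻ R a∈
      ... | inj₁ refl = x∈P
      ... | inj₂ a∈R  = p─q⊆p P blocked (R⊆ a∈R)

      independent′ : Independent _#_ (⁅ x ⁆ ∪ R)
      independent′ a∈ b∈ a≢b with x∈⁅y⁆∪p⁻ R a∈ | x∈⁅y⁆∪p⁻ R b∈
      ... | inj₁ refl | inj₁ refl = ⊥-elim (a≢b refl)
      ... | inj₁ refl | inj₂ b∈R  = x-free b∈R a≢b
      ... | inj₂ a∈R  | inj₁ refl = x-free a∈R (a≢b ∘ Eq.sym) ∘ #-sym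
      ... | inj₂ a∈R  | inj₂ b∈R  = independent a∈R b∈R a≢b

      ∣blocked∣≤1+c : ∣ blocked ∣ ≤ suc c
      ∣blocked∣≤1+c = ≤-trans (∣p∪q∣≤∣p∣+∣q∣ ⁅ x ⁆ (C x)) (+-mono-≤ (≤-reflexive (∣⁅x⁆∣≡1 x)) (∣C∣≤c x))

      bound′ : ∣ P ∣ ≤ suc c * ∣ ⁅ x ⁆ ∪ R ∣
      bound′ = begin
        ∣ P ∣                             ≡⟨ ∣p∣≡∣p─q∣+∣p∩q∣ P blocked ⟩
        ∣ P ─ blocked ∣ + ∣ P ∩ blocked ∣ ≤⟨ +-mono-≤ bound (≤-trans (∣p∩q∣≤∣q∣ P blocked) ∣blocked∣≤1+c) ⟩
        suc c * ∣ R ∣ + suc c             ≡⟨ +-comm (suc c * ∣ R ∣) (suc c) ⟩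
        suc c + suc c * ∣ R ∣             ≡⟨ Eq.sym (*-suc (suc c) ∣ R ∣) ⟩
        suc c * suc ∣ R ∣                 ≡⟨ cong (suc c *_) (Eq.sym (x∉p⇒∣⁅x⁆∪p∣≡1+∣p∣ x R x∉R)) ⟩
        suc c * ∣ ⁅ x ⁆ ∪ R ∣             ∎
        where open ≤-Reasoning

  largeIndependentSubset : ∀ P → LargeIndependentSubset P
  largeIndependentSubset P = go ∣ P ∣ P ≤-refl
    where
    go : ∀ m P → ∣ P ∣ ≤ m → LargeIndependentSubset P
    go zero    P ∣P∣≤0 = ∣P∣≡0⇒large (n≤0⇒n≡0 ∣P∣≤0)
    go (suc m) P ∣P∣≤1+m with nonempty? P
    ... | no empty        = ∣P∣≡0⇒large (Empty⇒∣p∣≡0 P empty)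
    ... | yes (x , x∈P)   = add x∈P (go m _ (≤-pred (≤-trans (∣P─blocked∣<∣P∣ x∈P) ∣P∣≤1+m)))

data Conflict {n} (G : Graph n) (a b : Fin n) : Set where
  common  : ∀ {v} → a ∈ N G v → b ∈ N G v → Conflict G a b
  bridged : ∀ {u v w} → u ≢ v → w ∈ N G u ∩ N G v →
            a ∈ N G u ─ N G v → b ∈ N G v ─ N G u → Conflict G a b

module _ {n : ℕ} (G : Graph n) where

  Conflict-sym : ∀ {a b} → Conflict G a b → Conflict G b a
  Conflict-sym (common a∈ b∈)            = common b∈ a∈
  Conflict-sym (bridged u≢v w∈ a∈ b∈) =
    bridged (u≢v ∘ Eq.sym) (x∈p∩q⁺ (swap (x∈p∩q⁻ _ _ w∈))) b∈ a∈

  nonBacktracking : ℕ → Fin n → Fin n → Subset n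
  nonBacktracking zero    prev x = ⁅ x ⁆
  nonBacktracking (suc k) prev x = ⋃[ y ∈ N G x - prev ] nonBacktracking k x y

  -- Endpoints of the non-backtracking walks a v b and a u w v b.
  conflicts : Fin n → Subset n
  conflicts a = ⋃[ v ∈ N G a ] (nonBacktracking 1 a v ∪ nonBacktracking 3 a v)

  conflicts-cover : ∀ {a b} → a ≢ b → Conflict G a b → b ∈ conflicts a
  conflicts-cover {a} a≢b (common {v} a∈Nv b∈Nv) =
    ∈⋃⁺ (sym G a v a∈Nv) (x∈p∪q⁺ (inj₁ (∈⋃⁺ (x∈p∧x≢y⇒x∈p-y b∈Nv (a≢b ∘ Eq.sym)) (x∈⁅x⁆ _))))
  conflicts-cover {a} {b} a≢b (bridged {u} {v} {w} u≢v w∈ a∈ b∈)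
    with x∈p∩q⁻ (N G u) (N G v) w∈ | x∈p─q⁻ (N G u) (N G v) a∈ | x∈p─q⁻ (N G v) (N G u) b∈
  ... | w∈Nu , w∈Nv | a∈Nu , a∉Nv | b∈Nv , b∉Nu =
    ∈⋃⁺ (sym G a u a∈Nu) (x∈p∪q⁺ (inj₂
      (∈⋃⁺ (x∈p∧x≢y⇒x∈p-y w∈Nu λ { refl → a∉Nv w∈Nv })
      (∈⋃⁺ (x∈p∧x≢y⇒x∈p-y (sym G w v w∈Nv) (u≢v ∘ Eq.sym))
      (∈⋃⁺ (x∈p∧x≢y⇒x∈p-y b∈Nv λ { refl → b∉Nu w∈Nu }) (x∈⁅x⁆ b))))))

  module _ (cubic : Cubic G) where

    ∣N-x∣≤2 : ∀ {x v} → x ∈ N G v → ∣ N G v - x ∣ ≤ 2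
    ∣N-x∣≤2 {v = v} x∈Nv = ≤-pred (subst (suc ∣ N G v - _ ∣ ≤_) (cubic v) (x∈p⇒∣p-x∣<∣p∣ x∈Nv))

    ∣nonBacktracking∣≤2^k : ∀ k {prev x} → prev ∈ N G x → ∣ nonBacktracking k prev x ∣ ≤ 2 ^ k
    ∣nonBacktracking∣≤2^k zero    {x = x} _ = ≤-reflexive (∣⁅x⁆∣≡1 x)
    ∣nonBacktracking∣≤2^k (suc k) {prev} {x} prev∈Nx =
      ∣⋃∣≤ (N G x - prev) (nonBacktracking k x) (∣N-x∣≤2 prev∈Nx) λ {y} y∈Nx-prev →
        ∣nonBacktracking∣≤2^k k (sym G y x (p─q⊆p _ _ y∈Nx-prev))

    ∣conflicts∣≤30 : ∀ a → ∣ conflicts a ∣ ≤ 30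
    ∣conflicts∣≤30 a = ∣⋃∣≤ (N G a) _ (≤-reflexive (cubic a)) ∣walks-via∣≤10
      where
      ∣walks-via∣≤10 : ∀ {v} → v ∈ N G a → ∣ nonBacktracking 1 a v ∪ nonBacktracking 3 a v ∣ ≤ 2 + 8
      ∣walks-via∣≤10 {v} v∈Na =
        ≤-trans (∣p∪q∣≤∣p∣+∣q∣ (nonBacktracking 1 a v) (nonBacktracking 3 a v))
                (+-mono-≤ (∣nonBacktracking∣≤2^k 1 a∈Nv) (∣nonBacktracking∣≤2^k 3 a∈Nv))
        where
        a∈Nv : a ∈ N G v
        a∈Nv = sym G v a v∈Na

module _ {n : ℕ} {G : Graph n} where

  distinguishable : HasDETOLD G → ∀ {u v} → u ≢ v →
                    2 ≤ ∣ N G u ─ N G v ∣ ⊎ 2 ≤ ∣ N G v ─ N G u ∣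
  distinguishable (S , _ , separates) {u} {v} u≢v with separates u v u≢v
  ... | inj₁ 2≤ = inj₁ (≤-trans 2≤ (p⊆q⇒∣p∣≤∣q∣ (p∩r─q∩r⊆p─q (N G u) (N G v) S)))
  ... | inj₂ 2≤ = inj₂ (≤-trans 2≤ (p⊆q⇒∣p∣≤∣q∣ (p∩r─q∩r⊆p─q (N G v) (N G u) S)))

  module _ (cubic : Cubic G) where

    ∣N─N∣-sym : ∀ u v → ∣ N G u ─ N G v ∣ ≡ ∣ N G v ─ N G u ∣
    ∣N─N∣-sym u v = +-cancelʳ-≡ ∣ N G u ∩ N G v ∣ _ _ (begin
      ∣ N G u ─ N G v ∣ + ∣ N G u ∩ N G v ∣ ≡⟨ Eq.sym (∣p∣≡∣p─q∣+∣p∩q∣ (N G u) (N G v)) ⟩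
      ∣ N G u ∣                             ≡⟨ Eq.trans (cubic u) (Eq.sym (cubic v)) ⟩
      ∣ N G v ∣                             ≡⟨ ∣p∣≡∣p─q∣+∣p∩q∣ (N G v) (N G u) ⟩
      ∣ N G v ─ N G u ∣ + ∣ N G v ∩ N G u ∣ ≡⟨ cong (λ s → ∣ N G v ─ N G u ∣ + ∣ s ∣) (∩-comm (N G v) (N G u)) ⟩
      ∣ N G v ─ N G u ∣ + ∣ N G u ∩ N G v ∣ ∎)
      where open Eq.≡-Reasoning

    2≤∣N─N∣ : HasDETOLD G → ∀ {u v} → u ≢ v → 2 ≤ ∣ N G u ─ N G v ∣
    2≤∣N─N∣ hasDETOLD {u} {v} u≢v with distinguishable hasDETOLD u≢v
    ... | inj₁ 2≤ = 2≤
    ... | inj₂ 2≤ = subst (2 ≤_) (Eq.sym (∣N─N∣-sym u v)) 2≤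

    module _ {R : Subset n} (independent : Independent (Conflict G) R) where

      ∣D∩R∣≤1 : ∀ {D w} → D ⊆ N G w → ∣ D ∩ R ∣ ≤ 1
      ∣D∩R∣≤1 {D} D⊆Nw = ∣p∣≤1 (D ∩ R) λ {x} {y} x∈ y∈ →
        let x∈D , x∈R = x∈p∩q⁻ D R x∈
            y∈D , y∈R = x∈p∩q⁻ D R y∈
        in decidable-stable (x ≟ y) λ x≢y → independent x∈R y∈R x≢y (common (D⊆Nw x∈D) (D⊆Nw y∈D))

      2≤∣N─R∣ : ∀ v → 2 ≤ ∣ N G v ─ R ∣
      2≤∣N─R∣ v = +-cancelʳ-≤ 1 2 ∣ N G v ─ R ∣ (begin
        3                               ≡⟨ Eq.sym (cubic v) ⟩
        ∣ N G v ∣                       ≡⟨ ∣p∣≡∣p─q∣+∣p∩q∣ (N G v) R ⟩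
        ∣ N G v ─ R ∣ + ∣ N G v ∩ R ∣   ≤⟨ +-monoʳ-≤ ∣ N G v ─ R ∣ (∣D∩R∣≤1 (λ x∈ → x∈)) ⟩
        ∣ N G v ─ R ∣ + 1               ∎)
        where open ≤-Reasoning

      wide-or-tight : HasDETOLD G → ∀ {u v} → u ≢ v →
        2 ≤ ∣ (N G u ─ N G v) ─ R ∣ ⊎ (Nonempty ((N G u ─ N G v) ∩ R) × Nonempty (N G u ∩ N G v))
      wide-or-tight hasDETOLD {u} {v} u≢v =
        map₂ (×-map (1≤∣p∣⇒Nonempty (D ∩ R)) (1≤∣p∣⇒Nonempty (N G u ∩ N G v)))
             (2≤x⊎[1≤e×1≤c] (∣ D ─ R ∣) (∣ D ∩ R ∣) (∣ N G u ∩ N G v ∣)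
                            (∣D∩R∣≤1 (p─q⊆p (N G u) (N G v))) 2≤∣D∣ ∣N[u]∣≡3)
        where
        D : Subset n
        D = N G u ─ N G v

        2≤∣D∣ : 2 ≤ ∣ D ─ R ∣ + ∣ D ∩ R ∣
        2≤∣D∣ = subst (2 ≤_) (∣p∣≡∣p─q∣+∣p∩q∣ D R) (2≤∣N─N∣ hasDETOLD u≢v)

        ∣N[u]∣≡3 : ∣ D ─ R ∣ + ∣ D ∩ R ∣ + ∣ N G u ∩ N G v ∣ ≡ 3
        ∣N[u]∣≡3 = begin
          ∣ D ─ R ∣ + ∣ D ∩ R ∣ + ∣ N G u ∩ N G v ∣ ≡⟨ cong (_+ ∣ N G u ∩ N G v ∣) (Eq.sym (∣p∣≡∣p─q∣+∣p∩q∣ D R)) ⟩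
          ∣ D ∣ + ∣ N G u ∩ N G v ∣                 ≡⟨ Eq.sym (∣p∣≡∣p─q∣+∣p∩q∣ (N G u) (N G v)) ⟩
          ∣ N G u ∣                                 ≡⟨ cubic u ⟩
          3                                         ∎
          where open Eq.≡-Reasoning

      ∁-separates : HasDETOLD G → ∀ {u v} → u ≢ v →
        2 ≤ ∣ N[ G ] ∁ R ⟨ u ⟩ ─ N[ G ] ∁ R ⟨ v ⟩ ∣ ⊎ 2 ≤ ∣ N[ G ] ∁ R ⟨ v ⟩ ─ N[ G ] ∁ R ⟨ u ⟩ ∣
      ∁-separates hasDETOLD {u} {v} u≢v
        with wide-or-tight hasDETOLD u≢v | wide-or-tight hasDETOLD (u≢v ∘ Eq.sym)
      ... | inj₁ 2≤ | _       = inj₁ (≤-trans 2≤ (p⊆q⇒∣p∣≤∣q∣ (p─q─r⊆p∩∁r─q∩∁r (N G u) (N G v) R)))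
      ... | inj₂ _  | inj₁ 2≤ = inj₂ (≤-trans 2≤ (p⊆q⇒∣p∣≤∣q∣ (p─q─r⊆p∩∁r─q∩∁r (N G v) (N G u) R)))
      ... | inj₂ ((a , a∈) , (w , w∈)) | inj₂ ((b , b∈) , _) =
        ⊥-elim (independent a∈R b∈R a≢b (bridged u≢v w∈ a∈D b∈D′))
        where
        a∈D : a ∈ N G u ─ N G v
        a∈D = proj₁ (x∈p∩q⁻ (N G u ─ N G v) R a∈)

        a∈R : a ∈ R
        a∈R = proj₂ (x∈p∩q⁻ (N G u ─ N G v) R a∈)

        b∈D′ : b ∈ N G v ─ N G u
        b∈D′ = proj₁ (x∈p∩q⁻ (N G v ─ N G u) R b∈)

        b∈R : b ∈ R
        b∈R = proj₂ (x∈p∩q⁻ (N G v ─ N G u) R b∈)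

        a≢b : a ≢ b
        a≢b refl = proj₂ (x∈p─q⁻ (N G u) (N G v) a∈D) (proj₁ (x∈p─q⁻ (N G v) (N G u) b∈D′))

      ∁-isDETOLD : HasDETOLD G → IsDETOLD G (∁ R)
      ∁-isDETOLD hasDETOLD =
        (λ v → ≤-trans (2≤∣N─R∣ v) (p⊆q⇒∣p∣≤∣q∣ (p─q⊆p∩∁q (N G v) R))) ,
        (λ u v u≢v → ∁-separates hasDETOLD u≢v)

m≤[1+c]r⇒[1+c][m∸r]≤cm : ∀ c m r → m ≤ suc c * r → suc c * (m ∸ r) ≤ c * m
m≤[1+c]r⇒[1+c][m∸r]≤cm c m r m≤[1+c]r = begin
  suc c * (m ∸ r)         ≡⟨ *-distribˡ-∸ (suc c) m r ⟩
  suc c * m ∸ suc c * r   ≤⟨ ∸-monoʳ-≤ (suc c * m) m≤[1+c]r ⟩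
  m + c * m ∸ m           ≡⟨ m+n∸m≡n m (c * m) ⟩
  c * m                   ∎
  where open ≤-Reasoning

theorem12 : ∀ (n : ℕ) (G : Graph n) → Cubic G → HasDETOLD G →
    ∀ (k : ℕ) → IsDETOLDNumber G k → 31 * k ≤ 30 * n
theorem12 n G cubic hasDETOLD k (_ , minimal)
  with Greedy.largeIndependentSubset (Conflict-sym G) (conflicts G) (conflicts-cover G)
                                     (∣conflicts∣≤30 G cubic) ⊤
... | R , _ , independent , ∣⊤∣≤31∣R∣ = begin
  31 * k           ≤⟨ *-monoʳ-≤ 31 (minimal (∁ R) (∁-isDETOLD cubic independent hasDETOLD)) ⟩
  31 * ∣ ∁ R ∣      ≡⟨ cong (31 *_) (∣∁p∣≡n∸∣p∣ R) ⟩
  31 * (n ∸ ∣ R ∣)  ≤⟨ m≤[1+c]r⇒[1+c][m∸r]≤cm 30 n ∣ R ∣ (subst (_≤ 31 * ∣ R ∣) (∣⊤∣≡n n) ∣⊤∣≤31∣R∣) ⟩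
  30 * n           ∎
  where open ≤-Reasoning
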